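{- Let $k\ge2$ and let $T$ be a tree obtained from the path $P_{2k-1}$ on $2k-1$ vertices by attaching $b\ge1$ pendent vertices to some vertices of $P_{2k-1}$. If the diameter of $T$ is $2k-2$ or $2k-1$, then $\mu(T)<k+\frac12$.
   Context: Attaching a pendent vertex to a vertex $x$ means adding a new vertex adjacent only to $x$. For a connected graph $H$ on $n$ vertices, the average distance is $\mu(H)=\binom{n}{2}^{ -1}\sum_{\{u,v\}\subset V(H)} d_H(u,v)$, where $d_H$ is the distance in $H$. -}

module Defs where

open import Data.Nat using (ℕ; zero; suc; _+_; _*_; _∸_; _≤_; _<ᵇ_)
open import Data.Fin using (Fin; zero; suc; toℕ; _↑ˡ_; _↑ʳ_)
open import Data.Bool using (if_then_else_)
open import Data.Product using (_×_; ∃₂)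
open import Relation.Binary.PropositionalEquality using (_≡_)

sumFin : (n : ℕ) → (Fin n → ℕ) → ℕ
sumFin zero    f = 0
sumFin (suc n) f = f zero + sumFin n (λ i → f (suc i))

pairSum : (n : ℕ) → (Fin n → Fin n → ℕ) → ℕ
pairSum n f = sumFin n (λ u → sumFin n (λ v → if toℕ u <ᵇ toℕ v then f u v else 0))

data Walk {V : Set} (Adj : V → V → Set) : V → V → ℕ → Set where
  nil  : ∀ {u} → Walk Adj u u 0
  cons : ∀ {u w v n} → Adj u w → Walk Adj w v n → Walk Adj u v (suc n)

IsDist : {V : Set} → (V → V → Set) → V → V → ℕ → Set
IsDist Adj u v n = Walk Adj u v n × (∀ m → Walk Adj u v m → n ≤ m)

-- The tree obtained from the path P_m (vertices 0..m-1, i ~ i+1) by attaching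
-- b pendent vertices; pendent vertex p is attached to path vertex (att p).
-- Vertex set: Fin (m + b); path vertex i is (i ↑ˡ b), pendent vertex p is (m ↑ʳ p).
data PendAdj (m b : ℕ) (att : Fin b → Fin m) : Fin (m + b) → Fin (m + b) → Set where
  path-fwd : (i j : Fin m) → suc (toℕ i) ≡ toℕ j → PendAdj m b att (i ↑ˡ b) (j ↑ˡ b)
  path-bwd : (i j : Fin m) → suc (toℕ i) ≡ toℕ j → PendAdj m b att (j ↑ˡ b) (i ↑ˡ b)
  pend-out : (p : Fin b) → PendAdj m b att (m ↑ʳ p) (att p ↑ˡ b)
  pend-in  : (p : Fin b) → PendAdj m b att (att p ↑ˡ b) (m ↑ʳ p)

IsDiameter : {n : ℕ} → (Fin n → Fin n → ℕ) → ℕ → Set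
IsDiameter {n} d D = (∃₂ λ u v → d u v ≡ D) × (∀ u v → d u v ≤ D)

-- Write m = 2k − 1 for the number of path vertices and a_p for the position of the path vertex
-- carrying pendant p. Every distance is at most the length of the obvious walk along the path:
-- |i − j| between path vertices, plus one for each pendant end. Since the diameter is at most m,
-- no two pendants hang at opposite ends of the path, so the a_p lie in a window of width m − 2 and
-- a weighted AM–GM argument bounds Σ_{p,q} |a_p − a_q| by b²(m − 2)/2. Adding up, the sum of d over
-- ordered pairs is at most m²(m − 1)/2 + b·m(m + 1) + 2b² + b²(m − 2)/2, which falls short of
-- (m + 2)(m + b)(m + b − 1)/2 by m(m − 1) + b(m − 2)/2 > 0; hence μ < (m + 2)/2 = k + 1/2.
module Submission where

open import Defs
open import Data.Nat using (ℕ; zero; suc; _+_; _*_; _∸_; _≤_; _<_; _<ᵇ_; _≟_; ∣_-_∣; z≤n; s≤s; s≤s⁻¹; z<s)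
open import Data.Nat.Properties
open import Algebra.Properties.CommutativeSemigroup +-commutativeSemigroup
  using (x∙yz≈y∙xz) renaming (interchange to +-interchange)
open import Data.Nat.Combinatorics using (_C_; nC1≡n; nCk+nC[k+1]≡[n+1]C[k+1])
open import Data.Nat.Tactic.RingSolver using (solve-∀)
open import Data.Fin using (Fin; zero; suc; toℕ; fromℕ<; _↑ˡ_; _↑ʳ_; splitAt)
open import Data.Fin.Properties using (toℕ-injective; toℕ<n; toℕ-fromℕ<; splitAt-↑ˡ; splitAt-↑ʳ; any?)
open import Data.Bool using (true; false; T; if_then_else_)
open import Data.Empty using (⊥)
open import Data.Product using (_,_; proj₁; proj₂)
open import Data.Sum using (_⊎_; inj₁; inj₂; [_,_]′)
open import Function using (_∘_)
open import Relation.Binary.Definitions using (Symmetric)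
open import Relation.Binary.PropositionalEquality
open import Relation.Nullary using (yes; no; contradiction)

sumFin-cong : ∀ n {f g : Fin n → ℕ} → (∀ i → f i ≡ g i) → sumFin n f ≡ sumFin n g
sumFin-cong zero    f≗g = refl
sumFin-cong (suc n) f≗g = cong₂ _+_ (f≗g zero) (sumFin-cong n (f≗g ∘ suc))

sumFin-mono-≤ : ∀ n {f g : Fin n → ℕ} → (∀ i → f i ≤ g i) → sumFin n f ≤ sumFin n g
sumFin-mono-≤ zero    f≤g = z≤n
sumFin-mono-≤ (suc n) f≤g = +-mono-≤ (f≤g zero) (sumFin-mono-≤ n (f≤g ∘ suc))

sumFin-+ : ∀ n (f g : Fin n → ℕ) → sumFin n (λ i → f i + g i) ≡ sumFin n f + sumFin n g
sumFin-+ zero    f g = refl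
sumFin-+ (suc n) f g =
  trans (cong (f zero + g zero +_) (sumFin-+ n (f ∘ suc) (g ∘ suc)))
        (+-interchange (f zero) (g zero) _ _)

sumFin-const : ∀ n c → sumFin n (λ _ → c) ≡ n * c
sumFin-const zero    c = refl
sumFin-const (suc n) c = cong (c +_) (sumFin-const n c)

sumFin-suc : ∀ n (f : Fin n → ℕ) → sumFin n (λ i → suc (f i)) ≡ n + sumFin n f
sumFin-suc zero    f = refl
sumFin-suc (suc n) f =
  cong suc (trans (cong (f zero +_) (sumFin-suc n (f ∘ suc))) (x∙yz≈y∙xz (f zero) n _))

*-distribˡ-sumFin : ∀ n c (f : Fin n → ℕ) → c * sumFin n f ≡ sumFin n (λ i → c * f i)
*-distribˡ-sumFin zero    c f = *-zeroʳ c
*-distribˡ-sumFin (suc n) c f =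
  trans (*-distribˡ-+ c (f zero) _) (cong (c * f zero +_) (*-distribˡ-sumFin n c (f ∘ suc)))

*-distribʳ-sumFin : ∀ n c (f : Fin n → ℕ) → sumFin n f * c ≡ sumFin n (λ i → f i * c)
*-distribʳ-sumFin n c f =
  trans (*-comm (sumFin n f) c)
        (trans (*-distribˡ-sumFin n c f) (sumFin-cong n (λ i → *-comm c (f i))))

sumFin-comm : ∀ n k (f : Fin n → Fin k → ℕ) →
  sumFin n (λ i → sumFin k (f i)) ≡ sumFin k (λ j → sumFin n (λ i → f i j))
sumFin-comm zero    k f = sym (trans (sumFin-const k 0) (*-zeroʳ k))
sumFin-comm (suc n) k f =
  trans (cong (sumFin k (f zero) +_) (sumFin-comm n k (f ∘ suc)))
        (sym (sumFin-+ k (f zero) (λ j → sumFin n (λ i → f (suc i) j))))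

sumFin-↑ : ∀ m n (f : Fin (m + n) → ℕ) →
  sumFin (m + n) f ≡ sumFin m (λ i → f (i ↑ˡ n)) + sumFin n (λ j → f (m ↑ʳ j))
sumFin-↑ zero    n f = refl
sumFin-↑ (suc m) n f =
  trans (cong (f zero +_) (sumFin-↑ m n (f ∘ suc))) (sym (+-assoc (f zero) _ _))

sumFin-≤-* : ∀ n {f : Fin n → ℕ} c → (∀ i → f i ≤ c) → sumFin n f ≤ n * c
sumFin-≤-* n c f≤c = subst (_ ≤_) (sumFin-const n c) (sumFin-mono-≤ n f≤c)

*-sumFin-≤-* : ∀ k n (f : Fin n → ℕ) c → (∀ i → k * f i ≤ c) → k * sumFin n f ≤ n * c
*-sumFin-≤-* k n f c kf≤c = subst (_≤ n * c) (sym (*-distribˡ-sumFin n k f)) (sumFin-≤-* n c kf≤c)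

2*[1+n]+[1+n]*n≡[2+n]*[1+n] : ∀ n → 2 * suc n + suc n * n ≡ suc (suc n) * suc n
2*[1+n]+[1+n]*n≡[2+n]*[1+n] = solve-∀

2*sumFin-toℕ : ∀ n → 2 * sumFin (suc n) toℕ ≡ suc n * n
2*sumFin-toℕ zero    = refl
2*sumFin-toℕ (suc n) = begin
  2 * sumFin (suc n) (suc ∘ toℕ)       ≡⟨ cong (2 *_) (sumFin-suc (suc n) toℕ) ⟩
  2 * (suc n + sumFin (suc n) toℕ)     ≡⟨ *-distribˡ-+ 2 (suc n) _ ⟩
  2 * suc n + 2 * sumFin (suc n) toℕ   ≡⟨ cong (2 * suc n +_) (2*sumFin-toℕ n) ⟩
  2 * suc n + suc n * n                ≡⟨ 2*[1+n]+[1+n]*n≡[2+n]*[1+n] n ⟩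
  suc (suc n) * suc n                  ∎
  where
  open ≡-Reasoning

2*sumFin-∣x-toℕ∣≤ : ∀ {x} n → x ≤ n → 2 * sumFin (suc n) (λ j → ∣ x - toℕ j ∣) ≤ suc n * n
2*sumFin-∣x-toℕ∣≤ {zero}  n       _        = ≤-reflexive (2*sumFin-toℕ n)
2*sumFin-∣x-toℕ∣≤ {suc x} (suc n) (s≤s x≤n) = begin
  2 * (suc x + S)           ≡⟨ *-distribˡ-+ 2 (suc x) S ⟩
  2 * suc x + 2 * S         ≤⟨ +-mono-≤ (*-monoʳ-≤ 2 (s≤s x≤n)) (2*sumFin-∣x-toℕ∣≤ n x≤n) ⟩
  2 * suc n + suc n * n     ≡⟨ 2*[1+n]+[1+n]*n≡[2+n]*[1+n] n ⟩
  suc (suc n) * suc n       ∎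
  where
  open ≤-Reasoning
  S : ℕ
  S = sumFin (suc n) (λ j → ∣ x - toℕ j ∣)

2*sumFin-1+∣x-toℕ∣≤ : ∀ {x} n → x ≤ n →
  2 * sumFin (suc n) (λ j → suc ∣ x - toℕ j ∣) ≤ suc n * suc (suc n)
2*sumFin-1+∣x-toℕ∣≤ {x} n x≤n = begin
  2 * sumFin (suc n) (λ j → suc ∣ x - toℕ j ∣) ≡⟨ cong (2 *_) (sumFin-suc (suc n) (λ j → ∣ x - toℕ j ∣)) ⟩
  2 * (suc n + S)                              ≡⟨ *-distribˡ-+ 2 (suc n) S ⟩
  2 * suc n + 2 * S                            ≤⟨ +-monoʳ-≤ (2 * suc n) (2*sumFin-∣x-toℕ∣≤ n x≤n) ⟩
  2 * suc n + suc n * n                        ≡⟨ 2*[1+n]+[1+n]*n≡[1+n]*[2+n] n ⟩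
  suc n * suc (suc n)                          ∎
  where
  open ≤-Reasoning
  S : ℕ
  S = sumFin (suc n) (λ j → ∣ x - toℕ j ∣)
  2*[1+n]+[1+n]*n≡[1+n]*[2+n] : ∀ n → 2 * suc n + suc n * n ≡ suc n * suc (suc n)
  2*[1+n]+[1+n]*n≡[1+n]*[2+n] = solve-∀

2*[nC2]≡n*[n∸1] : ∀ n → 2 * (n C 2) ≡ n * (n ∸ 1)
2*[nC2]≡n*[n∸1] zero    = refl
2*[nC2]≡n*[n∸1] (suc n) = begin
  2 * (suc n C 2)            ≡⟨ cong (2 *_) (nCk+nC[k+1]≡[n+1]C[k+1] n 1) ⟨
  2 * (n C 1 + n C 2)        ≡⟨ *-distribˡ-+ 2 (n C 1) (n C 2) ⟩
  2 * (n C 1) + 2 * (n C 2)  ≡⟨ cong₂ (λ x y → 2 * x + y) (nC1≡n n) (2*[nC2]≡n*[n∸1] n) ⟩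
  2 * n + n * (n ∸ 1)        ≡⟨ 2*n+n*[n∸1]≡[1+n]*n n ⟩
  suc n * n                  ∎
  where
  open ≡-Reasoning
  2*n+n*[n∸1]≡[1+n]*n : ∀ n → 2 * n + n * (n ∸ 1) ≡ suc n * n
  2*n+n*[n∸1]≡[1+n]*n zero    = refl
  2*n+n*[n∸1]≡[1+n]*n (suc n) = 2*[1+n]+[1+n]*n≡[2+n]*[1+n] n

am-gm : ∀ m n → 4 * (m * n) ≤ (m + n) * (m + n)
am-gm m n = [ ordered , flipped ]′ (≤-total m n)
  where
  square-split : ∀ m e → (m + (m + e)) * (m + (m + e)) ≡ 4 * (m * (m + e)) + e * e
  square-split = solve-∀
  ordered : ∀ {m n} → m ≤ n → 4 * (m * n) ≤ (m + n) * (m + n)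
  ordered {m} m≤n with m≤n⇒∃[o]m+o≡n m≤n
  ... | e , refl = subst (4 * (m * (m + e)) ≤_) (sym (square-split m e)) (m≤m+n _ (e * e))
  flipped : n ≤ m → 4 * (m * n) ≤ (m + n) * (m + n)
  flipped n≤m = subst₂ _≤_ (cong (4 *_) (*-comm n m)) (cong₂ _*_ (+-comm n m) (+-comm n m)) (ordered n≤m)

L*∣y-z∣≤y*[L∸z]+[L∸y]*z : ∀ {L y z} → y ≤ L → z ≤ L → L * ∣ y - z ∣ ≤ y * (L ∸ z) + (L ∸ y) * z
L*∣y-z∣≤y*[L∸z]+[L∸y]*z {L} {y} {z} y≤L z≤L = [ ordered y≤L z≤L , flipped ]′ (≤-total z y)
  where
  expand : ∀ z e f → (z + e + f) * e + 2 * (z * f) ≡ (z + e) * (e + f) + f * z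
  expand = solve-∀
  ordered : ∀ {L y z} → y ≤ L → z ≤ L → z ≤ y → L * ∣ y - z ∣ ≤ y * (L ∸ z) + (L ∸ y) * z
  ordered {z = z} y≤L _ z≤y with m≤n⇒∃[o]m+o≡n z≤y
  ... | e , refl with m≤n⇒∃[o]m+o≡n y≤L
  ...   | f , refl = begin
    (z + e + f) * ∣ z + e - z ∣    ≡⟨ cong ((z + e + f) *_) (trans (∣-∣-comm (z + e) z) (∣m-m+n∣≡n z e)) ⟩
    (z + e + f) * e                ≤⟨ m≤m+n _ (2 * (z * f)) ⟩
    (z + e + f) * e + 2 * (z * f)  ≡⟨ expand z e f ⟩
    (z + e) * (e + f) + f * z      ≡⟨ cong₂ (λ u v → (z + e) * u + v * z) L∸z (m+n∸m≡n (z + e) f) ⟨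
    (z + e) * (z + e + f ∸ z) + (z + e + f ∸ (z + e)) * z ∎
    where
    open ≤-Reasoning
    L∸z : z + e + f ∸ z ≡ e + f
    L∸z = trans (cong (_∸ z) (+-assoc z e f)) (m+n∸m≡n z (e + f))
  flipped : y ≤ z → L * ∣ y - z ∣ ≤ y * (L ∸ z) + (L ∸ y) * z
  flipped y≤z = subst₂ _≤_ (cong (L *_) (∣-∣-comm z y))
                  (trans (+-comm (z * (L ∸ y)) ((L ∸ z) * y))
                         (cong₂ _+_ (*-comm (L ∸ z) y) (*-comm z (L ∸ y))))
                  (ordered z≤L y≤L y≤z)

gapSum : (n : ℕ) → (Fin n → ℕ) → ℕ
gapSum n y = sumFin n (λ p → sumFin n (λ q → ∣ y p - y q ∣))

x*[2*y]≡2*[x*y] : ∀ x y → x * (2 * y) ≡ 2 * (x * y)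
x*[2*y]≡2*[x*y] = solve-∀

gapSum-≤ : ∀ n L (y : Fin n → ℕ) → (∀ p → y p ≤ L) → 2 * gapSum n y ≤ n * n * L
gapSum-≤ n zero y y≤0 = begin
  2 * gapSum n y     ≤⟨ *-monoʳ-≤ 2 (sumFin-≤-* n (n * 0) (λ p → sumFin-≤-* n 0 (≤-reflexive ∘ gap≡0 p))) ⟩
  2 * (n * (n * 0))  ≡⟨ 2*[n*[n*0]]≡n*n*0 n ⟩
  n * n * 0          ∎
  where
  open ≤-Reasoning
  gap≡0 : ∀ p q → ∣ y p - y q ∣ ≡ 0
  gap≡0 p q rewrite n≤0⇒n≡0 (y≤0 p) | n≤0⇒n≡0 (y≤0 q) = refl
  2*[n*[n*0]]≡n*n*0 : ∀ n → 2 * (n * (n * 0)) ≡ n * n * 0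
  2*[n*[n*0]]≡n*n*0 = solve-∀
gapSum-≤ n L@(suc _) y y≤L = *-cancelˡ-≤ L (begin
  L * (2 * gapSum n y)     ≡⟨ x*[2*y]≡2*[x*y] L (gapSum n y) ⟩
  2 * (L * gapSum n y)     ≤⟨ *-monoʳ-≤ 2 weighted ⟩
  2 * (Σy * Σt + Σt * Σy)  ≡⟨ 2*[x*y+y*x]≡4*[x*y] Σy Σt ⟩
  4 * (Σy * Σt)            ≤⟨ am-gm Σy Σt ⟩
  (Σy + Σt) * (Σy + Σt)    ≡⟨ cong₂ _*_ Σy+Σt≡n*L Σy+Σt≡n*L ⟩
  (n * L) * (n * L)        ≡⟨ [n*L]*[n*L]≡L*[n*n*L] n L ⟩
  L * (n * n * L)          ∎)
  where
  open ≤-Reasoning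
  t : Fin n → ℕ
  t p = L ∸ y p
  Σy Σt : ℕ
  Σy = sumFin n y
  Σt = sumFin n t
  Σy+Σt≡n*L : Σy + Σt ≡ n * L
  Σy+Σt≡n*L = trans (sym (sumFin-+ n y t))
                    (trans (sumFin-cong n (λ p → m+[n∸m]≡n (y≤L p))) (sumFin-const n L))
  weighted : L * gapSum n y ≤ Σy * Σt + Σt * Σy
  weighted = begin
    L * gapSum n y
      ≡⟨ trans (*-distribˡ-sumFin n L _) (sumFin-cong n (λ p → *-distribˡ-sumFin n L _)) ⟩
    sumFin n (λ p → sumFin n (λ q → L * ∣ y p - y q ∣))
      ≤⟨ sumFin-mono-≤ n (λ p → sumFin-mono-≤ n (λ q → L*∣y-z∣≤y*[L∸z]+[L∸y]*z (y≤L p) (y≤L q))) ⟩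
    sumFin n (λ p → sumFin n (λ q → y p * t q + t p * y q))
      ≡⟨ sumFin-cong n (λ p → trans (sumFin-+ n _ _)
           (sym (cong₂ _+_ (*-distribˡ-sumFin n (y p) t) (*-distribˡ-sumFin n (t p) y)))) ⟩
    sumFin n (λ p → y p * Σt + t p * Σy)
      ≡⟨ trans (sumFin-+ n _ _)
               (sym (cong₂ _+_ (*-distribʳ-sumFin n Σt y) (*-distribʳ-sumFin n Σy t))) ⟩
    Σy * Σt + Σt * Σy  ∎
  2*[x*y+y*x]≡4*[x*y] : ∀ x y → 2 * (x * y + y * x) ≡ 4 * (x * y)
  2*[x*y+y*x]≡4*[x*y] = solve-∀
  [n*L]*[n*L]≡L*[n*n*L] : ∀ n L → (n * L) * (n * L) ≡ L * (n * n * L)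
  [n*L]*[n*L]≡L*[n*n*L] = solve-∀

gapSum-≤-shifted : ∀ n α L (y : Fin n → ℕ) → (∀ p → α ≤ y p) → (∀ p → y p ≤ α + L) →
  2 * gapSum n y ≤ n * n * L
gapSum-≤-shifted n α L y α≤y y≤α+L =
  subst (λ g → 2 * g ≤ n * n * L) (sym gapSum-y≡gapSum-z)
        (gapSum-≤ n L z (λ p → m≤n+o⇒m∸n≤o (y p) α (y≤α+L p)))
  where
  z : Fin n → ℕ
  z p = y p ∸ α
  gapSum-y≡gapSum-z : gapSum n y ≡ gapSum n z
  gapSum-y≡gapSum-z = sumFin-cong n (λ p → sumFin-cong n (λ q →
    trans (cong₂ ∣_-_∣ (sym (m+[n∸m]≡n (α≤y p))) (sym (m+[n∸m]≡n (α≤y q))))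
          (∣m+n-m+o∣≡∣n-o∣ α (z p) (z q))))

2*pairSum≤sumFin² : ∀ n (d : Fin n → Fin n → ℕ) → (∀ u v → d u v ≡ d v u) →
  2 * pairSum n d ≤ sumFin n (λ u → sumFin n (d u))
2*pairSum≤sumFin² n d d-sym = begin
  2 * pairSum n d
    ≡⟨ cong (pairSum n d +_) (+-identityʳ _) ⟩
  pairSum n d + pairSum n d
    ≡⟨ cong (pairSum n d +_) (sumFin-comm n n H) ⟩
  sumFin n (λ u → sumFin n (H u)) + sumFin n (λ u → sumFin n (λ v → H v u))
    ≡⟨ sumFin-+ n _ _ ⟨
  sumFin n (λ u → sumFin n (H u) + sumFin n (λ v → H v u))
    ≡⟨ sumFin-cong n (λ u → sumFin-+ n _ _) ⟨
  sumFin n (λ u → sumFin n (λ v → H u v + H v u))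
    ≤⟨ sumFin-mono-≤ n (λ u → sumFin-mono-≤ n (H+Hᵀ≤d u)) ⟩
  sumFin n (λ u → sumFin n (d u))  ∎
  where
  open ≤-Reasoning
  H : Fin n → Fin n → ℕ
  H u v = if toℕ u <ᵇ toℕ v then d u v else 0
  H+Hᵀ≤d : ∀ u v → H u v + H v u ≤ d u v
  H+Hᵀ≤d u v with toℕ u <ᵇ toℕ v in u<v | toℕ v <ᵇ toℕ u in v<u
  ... | true  | true  = contradiction (<ᵇ⇒< (toℕ v) (toℕ u) (subst T (sym v<u) _))
                                      (<⇒≯ (<ᵇ⇒< (toℕ u) (toℕ v) (subst T (sym u<v) _)))
  ... | true  | false = ≤-reflexive (+-identityʳ (d u v))
  ... | false | true  = ≤-reflexive (d-sym v u)
  ... | false | false = z≤n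

module _ {V : Set} {Adj : V → V → Set} where

  snoc : ∀ {u v w n} → Walk Adj u v n → Adj v w → Walk Adj u w (suc n)
  snoc nil        e′ = cons e′ nil
  snoc (cons e w) e′ = cons e (snoc w e′)

  reverse : Symmetric Adj → ∀ {u v n} → Walk Adj u v n → Walk Adj v u n
  reverse adj-sym nil        = nil
  reverse adj-sym (cons e w) = snoc (reverse adj-sym w) (adj-sym e)

  IsDist-sym : Symmetric Adj → ∀ {u v m n} → IsDist Adj u v m → IsDist Adj v u n → m ≡ n
  IsDist-sym adj-sym (wᵤᵥ , minᵤᵥ) (wᵥᵤ , minᵥᵤ) =
    ≤-antisym (minᵤᵥ _ (reverse adj-sym wᵥᵤ)) (minᵥᵤ _ (reverse adj-sym wᵤᵥ))

  potential-≤-length : (h : V → ℕ) → (∀ {u v} → Adj u v → h u ≤ suc (h v)) →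
    ∀ {u v n} → Walk Adj u v n → h u ≤ n + h v
  potential-≤-length h h-step nil        = ≤-refl
  potential-≤-length h h-step (cons e w) = ≤-trans (h-step e) (s≤s (potential-≤-length h h-step w))

module PendantPath {m b : ℕ} (att : Fin b → Fin m) where

  PendAdj-sym : Symmetric (PendAdj m b att)
  PendAdj-sym (path-fwd i j i+1≡j) = path-bwd i j i+1≡j
  PendAdj-sym (path-bwd i j i+1≡j) = path-fwd i j i+1≡j
  PendAdj-sym (pend-out p)         = pend-in p
  PendAdj-sym (pend-in p)          = pend-out p

  ascend : ∀ n (i j : Fin m) → toℕ i + n ≡ toℕ j → Walk (PendAdj m b att) (i ↑ˡ b) (j ↑ˡ b) n
  ascend zero    i j i+0≡j =
    subst (λ k → Walk (PendAdj m b att) (i ↑ˡ b) (k ↑ˡ b) 0)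
          (toℕ-injective (trans (sym (+-identityʳ _)) i+0≡j)) nil
  ascend (suc n) i j i+[1+n]≡j = cons (path-fwd i i⁺ (sym (toℕ-fromℕ< i⁺<m))) (ascend n i⁺ j i⁺+n≡j)
    where
    1+i+n≡j : suc (toℕ i + n) ≡ toℕ j
    1+i+n≡j = trans (sym (+-suc (toℕ i) n)) i+[1+n]≡j
    i⁺<m : suc (toℕ i) < m
    i⁺<m = ≤-trans (s≤s (s≤s (m≤m+n (toℕ i) n)))
                   (subst (λ x → suc x ≤ m) (sym 1+i+n≡j) (toℕ<n j))
    i⁺ : Fin m
    i⁺ = fromℕ< i⁺<m
    i⁺+n≡j : toℕ i⁺ + n ≡ toℕ j
    i⁺+n≡j = trans (cong (_+ n) (toℕ-fromℕ< i⁺<m)) 1+i+n≡j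

  pathWalk : (i j : Fin m) → Walk (PendAdj m b att) (i ↑ˡ b) (j ↑ˡ b) ∣ toℕ i - toℕ j ∣
  pathWalk i j with ≤-total (toℕ i) (toℕ j)
  ... | inj₁ i≤j = subst (Walk _ _ _) (sym (m≤n⇒∣m-n∣≡n∸m i≤j)) (ascend _ i j (m+[n∸m]≡n i≤j))
  ... | inj₂ j≤i = subst (Walk _ _ _) (sym (m≤n⇒∣n-m∣≡n∸m j≤i))
                     (reverse PendAdj-sym (ascend _ j i (m+[n∸m]≡n j≤i)))

  module Distances (d : Fin (m + b) → Fin (m + b) → ℕ)
                   (isDist : ∀ u v → IsDist (PendAdj m b att) u v (d u v)) where

    a : Fin b → ℕ
    a p = toℕ (att p)

    d-sym : ∀ u v → d u v ≡ d v u
    d-sym u v = IsDist-sym PendAdj-sym (isDist u v) (isDist v u)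

    d≤length : ∀ {u v n} → Walk (PendAdj m b att) u v n → d u v ≤ n
    d≤length {u} {v} w = proj₂ (isDist u v) _ w

    d-path-path≤ : ∀ i j → d (i ↑ˡ b) (j ↑ˡ b) ≤ ∣ toℕ i - toℕ j ∣
    d-path-path≤ i j = d≤length (pathWalk i j)

    d-pend-path≤ : ∀ p i → d (m ↑ʳ p) (i ↑ˡ b) ≤ suc ∣ a p - toℕ i ∣
    d-pend-path≤ p i = d≤length (cons (pend-out p) (pathWalk (att p) i))

    d-pend-pend≤ : ∀ p q → d (m ↑ʳ p) (m ↑ʳ q) ≤ 2 + ∣ a p - a q ∣
    d-pend-pend≤ p q = d≤length (cons (pend-out p) (snoc (pathWalk (att p) (att q)) (pend-in q)))

module DiameterAtMostPathLength
  {L b : ℕ} (att : Fin b → Fin (suc (suc L)))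
  (d : Fin (suc (suc L) + b) → Fin (suc (suc L) + b) → ℕ)
  (isDist : ∀ u v → IsDist (PendAdj (suc (suc L)) b att) u v (d u v))
  (d≤2+L : ∀ u v → d u v ≤ suc (suc L))
  where

  open PendantPath att
  open Distances d isDist

  m N : ℕ
  m = suc (suc L)
  N = m + b

  a≤1+L : ∀ p → a p ≤ suc L
  a≤1+L p = s≤s⁻¹ (toℕ<n (att p))

  -- A pendant at 0 sits one level below its anchor and a pendant at L + 1 one level above,
  -- so a walk between two such pendants climbs m + 1 levels.
  pendantLevel : ℕ → ℕ
  pendantLevel zero    = zero
  pendantLevel (suc x) = suc (suc x) + (suc x ∸ L)

  pendantLevel-≥ : ∀ x → x ≤ pendantLevel x
  pendantLevel-≥ zero    = z≤n
  pendantLevel-≥ (suc x) = ≤-trans (n≤1+n (suc x)) (m≤m+n _ _)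

  pendantLevel-≤ : ∀ x → x ≤ suc L → pendantLevel x ≤ suc (suc x)
  pendantLevel-≤ zero    _      = z≤n
  pendantLevel-≤ (suc x) x≤1+L =
    ≤-trans (+-monoʳ-≤ (suc (suc x)) (m≤n+o⇒m∸n≤o (suc x) L (subst (suc x ≤_) (+-comm 1 L) x≤1+L)))
            (≤-reflexive (+-comm (suc (suc x)) 1))

  level : Fin N → ℕ
  level u = [ suc ∘ toℕ , pendantLevel ∘ a ]′ (splitAt m u)

  level-path : ∀ i → level (i ↑ˡ b) ≡ suc (toℕ i)
  level-path i rewrite splitAt-↑ˡ m i b = refl

  level-pend : ∀ p → level (m ↑ʳ p) ≡ pendantLevel (a p)
  level-pend p rewrite splitAt-↑ʳ m b p = refl

  level-step : ∀ {u v} → PendAdj m b att u v → level u ≤ suc (level v)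
  level-step (path-fwd i j i+1≡j) rewrite level-path i | level-path j =
    s≤s (≤-trans (n≤1+n (toℕ i)) (≤-trans (≤-reflexive i+1≡j) (n≤1+n (toℕ j))))
  level-step (path-bwd i j i+1≡j) rewrite level-path i | level-path j = s≤s (≤-reflexive (sym i+1≡j))
  level-step (pend-out p) rewrite level-pend p | level-path (att p) = pendantLevel-≤ (a p) (a≤1+L p)
  level-step (pend-in p)  rewrite level-pend p | level-path (att p) = s≤s (pendantLevel-≥ (a p))

  pendants-not-at-both-ends : ∀ p q → a p ≡ suc L → a q ≡ 0 → ⊥
  pendants-not-at-both-ends p q ap≡1+L aq≡0 = 1+n≰n (begin
    suc m                 ≡⟨ +-comm m 1 ⟨
    m + 1                 ≡⟨ cong (m +_) (m+n∸n≡m 1 L) ⟨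
    pendantLevel (suc L)  ≡⟨ trans (level-pend p) (cong pendantLevel ap≡1+L) ⟨
    level (m ↑ʳ p)        ≤⟨ potential-≤-length level level-step (proj₁ (isDist (m ↑ʳ p) (m ↑ʳ q))) ⟩
    dpq + level (m ↑ʳ q)  ≡⟨ cong (dpq +_) (trans (level-pend q) (cong pendantLevel aq≡0)) ⟩
    dpq + 0               ≡⟨ +-identityʳ dpq ⟩
    dpq                   ≤⟨ d≤2+L _ _ ⟩
    m                     ∎)
    where
    open ≤-Reasoning
    dpq : ℕ
    dpq = d (m ↑ʳ p) (m ↑ʳ q)

  2*gapSum-a≤ : 2 * gapSum b a ≤ b * b * L
  2*gapSum-a≤ with any? (λ q → a q ≟ suc L)
  ... | yes (q , aq≡1+L) = gapSum-≤-shifted b 1 L a 1≤a a≤1+L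
    where
    1≤a : ∀ p → 1 ≤ a p
    1≤a p = ≤∧≢⇒< z≤n (λ 0≡ap → pendants-not-at-both-ends q p aq≡1+L (sym 0≡ap))
  ... | no  ∄q           = gapSum-≤-shifted b 0 L a (λ _ → z≤n) a≤L
    where
    a≤L : ∀ p → a p ≤ L
    a≤L p = s≤s⁻¹ (≤∧≢⇒< (a≤1+L p) (λ ap≡1+L → ∄q (p , ap≡1+L)))

  PP PQ QP QQ : ℕ
  PP = sumFin m (λ i → sumFin m (λ j → d (i ↑ˡ b) (j ↑ˡ b)))
  PQ = sumFin m (λ i → sumFin b (λ q → d (i ↑ˡ b) (m ↑ʳ q)))
  QP = sumFin b (λ p → sumFin m (λ j → d (m ↑ʳ p) (j ↑ˡ b)))
  QQ = sumFin b (λ p → sumFin b (λ q → d (m ↑ʳ p) (m ↑ʳ q)))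

  sumFin²-d≡blocks : sumFin N (λ u → sumFin N (d u)) ≡ (PP + PQ) + (QP + QQ)
  sumFin²-d≡blocks = trans (sumFin-↑ m b (λ u → sumFin N (d u))) (cong₂ _+_
    (trans (sumFin-cong m (λ i → sumFin-↑ m b (d (i ↑ˡ b))))
           (sumFin-+ m (λ i → sumFin m (λ j → d (i ↑ˡ b) (j ↑ˡ b)))
                       (λ i → sumFin b (λ q → d (i ↑ˡ b) (m ↑ʳ q)))))
    (trans (sumFin-cong b (λ p → sumFin-↑ m b (d (m ↑ʳ p))))
           (sumFin-+ b (λ p → sumFin m (λ j → d (m ↑ʳ p) (j ↑ˡ b)))
                       (λ p → sumFin b (λ q → d (m ↑ʳ p) (m ↑ʳ q))))))

  PQ≡QP : PQ ≡ QP
  PQ≡QP = trans (sumFin-comm m b (λ i q → d (i ↑ˡ b) (m ↑ʳ q)))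
                (sumFin-cong b (λ p → sumFin-cong m (λ i → d-sym (i ↑ˡ b) (m ↑ʳ p))))

  2*PP≤ : 2 * PP ≤ m * (m * suc L)
  2*PP≤ = *-sumFin-≤-* 2 m (λ i → sumFin m (λ j → d (i ↑ˡ b) (j ↑ˡ b))) (m * suc L) row
    where
    row : ∀ i → 2 * sumFin m (λ j → d (i ↑ˡ b) (j ↑ˡ b)) ≤ m * suc L
    row i = ≤-trans (*-monoʳ-≤ 2 (sumFin-mono-≤ m (d-path-path≤ i)))
                    (2*sumFin-∣x-toℕ∣≤ (suc L) (s≤s⁻¹ (toℕ<n i)))

  2*QP≤ : 2 * QP ≤ b * (m * suc m)
  2*QP≤ = *-sumFin-≤-* 2 b (λ p → sumFin m (λ j → d (m ↑ʳ p) (j ↑ˡ b))) (m * suc m) row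
    where
    row : ∀ p → 2 * sumFin m (λ j → d (m ↑ʳ p) (j ↑ˡ b)) ≤ m * suc m
    row p = ≤-trans (*-monoʳ-≤ 2 (sumFin-mono-≤ m (d-pend-path≤ p)))
                    (2*sumFin-1+∣x-toℕ∣≤ (suc L) (a≤1+L p))

  2*QQ≤ : 2 * QQ ≤ 2 * (b * (b * 2)) + b * b * L
  2*QQ≤ = begin
    2 * QQ
      ≤⟨ *-monoʳ-≤ 2 (sumFin-mono-≤ b (λ p → sumFin-mono-≤ b (d-pend-pend≤ p))) ⟩
    2 * sumFin b (λ p → sumFin b (λ q → 2 + ∣ a p - a q ∣))
      ≡⟨ cong (2 *_) (sumFin-cong b (λ p → sumFin-+ b (λ _ → 2) (λ q → ∣ a p - a q ∣))) ⟩
    2 * sumFin b (λ p → sumFin b (λ _ → 2) + sumFin b (λ q → ∣ a p - a q ∣))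
      ≡⟨ cong (2 *_) (sumFin-+ b (λ _ → sumFin b (λ _ → 2)) (λ p → sumFin b (λ q → ∣ a p - a q ∣))) ⟩
    2 * (sumFin b (λ _ → sumFin b (λ _ → 2)) + gapSum b a)
      ≡⟨ cong (λ x → 2 * (x + gapSum b a)) (trans (sumFin-const b _) (cong (b *_) (sumFin-const b 2))) ⟩
    2 * (b * (b * 2) + gapSum b a)
      ≡⟨ *-distribˡ-+ 2 (b * (b * 2)) _ ⟩
    2 * (b * (b * 2)) + 2 * gapSum b a
      ≤⟨ +-monoʳ-≤ (2 * (b * (b * 2))) 2*gapSum-a≤ ⟩
    2 * (b * (b * 2)) + b * b * L  ∎
    where open ≤-Reasoning

  Bound : ℕ
  Bound = m * (m * suc L) + b * (m * suc m) + (b * (m * suc m) + (2 * (b * (b * 2)) + b * b * L))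

  2*sumFin²-d≤Bound : 2 * sumFin N (λ u → sumFin N (d u)) ≤ Bound
  2*sumFin²-d≤Bound = begin
    2 * sumFin N (λ u → sumFin N (d u))        ≡⟨ cong (2 *_) sumFin²-d≡blocks ⟩
    2 * ((PP + PQ) + (QP + QQ))                ≡⟨ 2*-distrib₄ PP PQ QP QQ ⟩
    2 * PP + 2 * PQ + (2 * QP + 2 * QQ)        ≤⟨ +-mono-≤ (+-mono-≤ 2*PP≤ 2*PQ≤) (+-mono-≤ 2*QP≤ 2*QQ≤) ⟩
    Bound                                      ∎
    where
    open ≤-Reasoning
    2*-distrib₄ : ∀ w x y z → 2 * ((w + x) + (y + z)) ≡ 2 * w + 2 * x + (2 * y + 2 * z)
    2*-distrib₄ = solve-∀
    2*PQ≤ : 2 * PQ ≤ b * (m * suc m)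
    2*PQ≤ = subst (λ x → 2 * x ≤ b * (m * suc m)) (sym PQ≡QP) 2*QP≤

  2*pairSum< : 2 * pairSum N d < (m + 2) * (N C 2)
  2*pairSum< = *-cancelˡ-< 2 (2 * pairSum N d) ((m + 2) * (N C 2)) (begin-strict
    2 * (2 * pairSum N d)                ≤⟨ *-monoʳ-≤ 2 (2*pairSum≤sumFin² N d d-sym) ⟩
    2 * sumFin N (λ u → sumFin N (d u))  ≤⟨ 2*sumFin²-d≤Bound ⟩
    Bound                                <⟨ m<m+n Bound z<s ⟩
    Bound + (2 * (m * suc L) + b * L)    ≡⟨ Bound+slack≡ L b ⟩
    (m + 2) * (N * (N ∸ 1))              ≡⟨ cong ((m + 2) *_) (2*[nC2]≡n*[n∸1] N) ⟨
    (m + 2) * (2 * (N C 2))              ≡⟨ x*[2*y]≡2*[x*y] (m + 2) (N C 2) ⟩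
    2 * ((m + 2) * (N C 2))              ∎)
    where
    open ≤-Reasoning
    Bound+slack≡ : ∀ L b → let m = suc (suc L) in
      m * (m * suc L) + b * (m * suc m) + (b * (m * suc m) + (2 * (b * (b * 2)) + b * b * L))
        + (2 * (m * suc L) + b * L)
      ≡ (m + 2) * ((m + b) * suc (L + b))
    Bound+slack≡ = solve-∀

pendantPath-2*pairSum< : ∀ m b → 2 ≤ m → (att : Fin b → Fin m) (d : Fin (m + b) → Fin (m + b) → ℕ) →
  (∀ u v → IsDist (PendAdj m b att) u v (d u v)) → (∀ u v → d u v ≤ m) →
  2 * pairSum (m + b) d < (m + 2) * ((m + b) C 2)
pendantPath-2*pairSum< (suc (suc L)) b (s≤s (s≤s z≤n)) att d isDist d≤m =
  DiameterAtMostPathLength.2*pairSum< att d isDist d≤m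

lemma5p2 : (k b : ℕ) → 2 ≤ k → 1 ≤ b
    → (att : Fin b → Fin (2 * k ∸ 1))
    → (d : Fin ((2 * k ∸ 1) + b) → Fin ((2 * k ∸ 1) + b) → ℕ)
    → (∀ u v → IsDist (PendAdj (2 * k ∸ 1) b att) u v (d u v))
    → (IsDiameter d (2 * k ∸ 2) ⊎ IsDiameter d (2 * k ∸ 1))
    → 2 * pairSum ((2 * k ∸ 1) + b) d < (2 * k + 1) * (((2 * k ∸ 1) + b) C 2)
lemma5p2 k b 2≤k _ att d isDist diameter =
  subst (λ c → 2 * pairSum (m + b) d < c * ((m + b) C 2)) m+2≡2k+1
        (pendantPath-2*pairSum< m b 2≤m att d isDist d≤m)
  where
  m : ℕ
  m = 2 * k ∸ 1
  4≤2k : 4 ≤ 2 * k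
  4≤2k = *-monoʳ-≤ 2 2≤k
  2≤m : 2 ≤ m
  2≤m = ∸-monoˡ-≤ 1 (≤-trans (n≤1+n 3) 4≤2k)
  m+2≡2k+1 : m + 2 ≡ 2 * k + 1
  m+2≡2k+1 = trans (+-suc m 1) (trans (cong suc (m∸n+n≡m (≤-trans (s≤s z≤n) 4≤2k))) (+-comm 1 (2 * k)))
  d≤m : ∀ u v → d u v ≤ m
  d≤m u v = [ (λ D → ≤-trans (proj₂ D u v) (∸-monoʳ-≤ (2 * k) (s≤s z≤n))) , (λ D → proj₂ D u v) ]′
              diameter
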